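{- Let $m\ge1$, $q=2^m$, $k=\mathbb F_q$, $k_2=\mathbb F_{q^2}$, $a\in k^*$, $b\in k$, and $P(x)=a^2x^5+b^2x+a$. Let $v\in k$ satisfy $v^5P(v)=1$, and write $v=z+z'$ with $z,z'\in\bar k$ roots of $P(x)$. Then: if $(av^5)^{ -1}\in\operatorname{AS}(k)$, then $z,z'\in k$; if $(av^5)^{ -1}\notin\operatorname{AS}(k)$, then $z,z'\in k_2\setminus k$ and they are conjugate over $k$.
   Context: $\operatorname{AS}\colon k\to k$, $\operatorname{AS}(x)=x+x^2$, and $\operatorname{AS}(k)$ denotes its image (equal to the kernel of the absolute trace $k\to\mathbb F_2$). Every $v\in\bar k$ with $v^5P(v)=1$ is a sum of two distinct roots of $P$ in $\bar k$. -}

module Defs where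

open import Level using (_⊔_)
open import Algebra.Bundles using (CommutativeRing; Semiring)
import Algebra.Definitions.RawSemiring as RS
open import Data.Nat as ℕ using (ℕ; suc)
open import Data.List using (List; []; _∷_; _∷ʳ_)
open import Data.Product using (∃; _×_)
open import Relation.Nullary using (¬_)

module FieldNotions {c ℓ} (L : CommutativeRing c ℓ) where
  open CommutativeRing L
  open RS (Semiring.rawSemiring semiring) public using (_^_)

  record IsField : Set (c ⊔ ℓ) where
    field
      1≉0 : ¬ (1# ≈ 0#)
      inverse : ∀ x → ¬ (x ≈ 0#) → ∃ λ y → x * y ≈ 1#

  Char2 : Set ℓ
  Char2 = 1# + 1# ≈ 0#

  -- Horner evaluation of a polynomial given by its coefficient list
  -- (constant term first): eval (c₀ ∷ c₁ ∷ …) x = c₀ + c₁ x + …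
  eval : List Carrier → Carrier → Carrier
  eval [] x = 0#
  eval (a ∷ as) x = a + x * eval as x

  -- algebraically closed: every monic polynomial of degree ≥ 1,
  -- c₀ + c₁ x + … + cₙ xⁿ + x^(n+1), has a root.
  AlgClosed : Set (c ⊔ ℓ)
  AlgClosed = ∀ (a : Carrier) (as : List Carrier) →
    ∃ λ x → eval ((a ∷ as) ∷ʳ 1#) x ≈ 0#

  -- Inside an algebraic closure L of 𝔽₂, the subfield 𝔽_Q (Q a power of 2)
  -- is the set of roots of x^Q - x, i.e. the fixed points of x ↦ x^Q.
  InF : ℕ → Carrier → Set ℓ
  InF Q x = x ^ Q ≈ x

  AS : Carrier → Carrier
  AS x = x + x ^ 2

  InAS : ℕ → Carrier → Set (c ⊔ ℓ)
  InAS Q w = ∃ λ x → InF Q x × AS x ≈ w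

  P : Carrier → Carrier → Carrier → Carrier
  P a b x = a ^ 2 * x ^ 5 + b ^ 2 * x + a

{-# OPTIONS --safe #-}
-- In characteristic 2, z′ P(z) + z P(z′) = a v (a z z′ v³ + 1) with v = z + z′,
-- so a z z′ v³ = 1 and y = z / v satisfies y² + y = z z′ / v² = 1 / (a v⁵) = w;
-- thus z = v y and z′ = v (y + 1).  Two roots of t² + t = w differ by an
-- idempotent, i.e. by 0 or 1.  If w = x² + x with x ∈ k, then y + x ∈ 𝔽₂ ⊆ k, so
-- y, z, z′ ∈ k.  Otherwise y ∉ k while y^q is another root, so y^q = y + 1 and
-- Frobenius swaps z and z′.
module Submission where

open import Defs
open import Algebra.Bundles using (CommutativeRing)
open import Data.Nat using (ℕ; _≤_)
open import Data.Product using (_×_)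
open import Relation.Nullary using (¬_)
import Data.Nat as N

open import Algebra.Bundles using (RawRing)
import Algebra.Properties.Monoid.Mult
import Algebra.Solver.Ring
open import Algebra.Solver.Ring.AlmostCommutativeRing
  using (fromCommutativeRing; _-Raw-AlmostCommutative⟶_)
open import Data.Bool.Base using (Bool; true; false; _xor_; _∧_)
open import Data.Bool.Properties using (xor-∧-commutativeRing)
open import Data.Maybe.Base using (Maybe; just; nothing)
import Data.Nat.Properties as ℕₚ
open import Data.Product using (_,_)
open import Function.Base using (_∘_)
open import Level using (0ℓ)

module FrobeniusFixedPoints {c ℓ} (L : CommutativeRing c ℓ) where
  open CommutativeRing L
  open FieldNotions L
  open import Algebra.Properties.Semiring.Exp semiring using (^-congˡ; ^-assocʳ)
  open import Algebra.Properties.CommutativeSemiring.Exp commutativeSemiring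
    using (^-distrib-*)
  open Algebra.Properties.Monoid.Mult *-monoid using (×-idem)
  open import Relation.Binary.Reasoning.Setoid setoid

  InF-resp : ∀ {Q x y} → x ≈ y → InF Q x → InF Q y
  InF-resp {Q} x≈y x∈ = trans (^-congˡ Q (sym x≈y)) (trans x∈ x≈y)

  InF-1 : ∀ Q → InF Q 1#
  InF-1 N.zero    = refl
  InF-1 (N.suc Q) = trans (*-identityˡ _) (InF-1 Q)

  InF-* : ∀ {Q x y} → InF Q x → InF Q y → InF Q (x * y)
  InF-* {Q} {x} {y} x∈ y∈ = trans (^-distrib-* x y Q) (*-cong x∈ y∈)

  InF-^ : ∀ {Q x} → InF Q x → ∀ n → InF Q (x ^ n)
  InF-^ {Q} x∈ N.zero    = InF-1 Q
  InF-^ {Q} x∈ (N.suc n) = InF-* {Q} x∈ (InF-^ {Q} x∈ n)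

  InF-inverse : ∀ {Q x y} → InF Q x → x * y ≈ 1# → InF Q y
  InF-inverse {Q} {x} {y} x∈ x·y≈1 = begin
    y ^ Q              ≈⟨ sym (*-identityˡ _) ⟩
    1# * y ^ Q         ≈⟨ *-congʳ (sym x·y≈1) ⟩
    (x * y) * y ^ Q    ≈⟨ *-congʳ (*-comm x y) ⟩
    (y * x) * y ^ Q    ≈⟨ *-assoc y x (y ^ Q) ⟩
    y * (x * y ^ Q)    ≈⟨ *-congˡ (*-congʳ (sym x∈)) ⟩
    y * (x ^ Q * y ^ Q) ≈⟨ *-congˡ (sym (^-distrib-* x y Q)) ⟩
    y * (x * y) ^ Q    ≈⟨ *-congˡ (^-congˡ Q x·y≈1) ⟩
    y * 1# ^ Q         ≈⟨ *-congˡ (InF-1 Q) ⟩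
    y * 1#             ≈⟨ *-identityʳ y ⟩
    y                  ∎

  swapped⇒InF-square : ∀ {Q x y} → x ^ Q ≈ y → y ^ Q ≈ x → InF (Q N.* Q) x
  swapped⇒InF-square {Q} {x} x^Q≈y y^Q≈x =
    trans (sym (^-assocʳ x Q Q)) (trans (^-congˡ Q x^Q≈y) y^Q≈x)

  idempotent⇒InF : ∀ {x} → x * x ≈ x → ∀ n → InF (2 N.^ n) x
  idempotent⇒InF x·x≈x n = ×-idem x·x≈x (2 N.^ n) {{ℕₚ.m^n≢0 2 n}}

module Characteristic2 {c ℓ} (L : CommutativeRing c ℓ) (char2 : FieldNotions.Char2 L) where
  open CommutativeRing L
  open FieldNotions L
  open FrobeniusFixedPoints L
  open import Algebra.Properties.Semiring.Exp semiring using (^-congˡ; ^-congʳ; ^-assocʳ)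
  open import Algebra.Properties.CommutativeSemiring.Exp commutativeSemiring
    using (^-distrib-*)
  open import Algebra.Properties.Ring ring using (-0#≈0#)
  open import Algebra.Properties.Group +-group using (inverseʳ-unique)
  open import Relation.Binary.Reasoning.Setoid setoid

  -- Ring solver with coefficients in 𝔽₂ = (Bool, xor, ∧): it also proves the
  -- identities that hold only in characteristic 2.
  𝔽₂ : RawRing 0ℓ 0ℓ
  𝔽₂ = CommutativeRing.rawRing xor-∧-commutativeRing

  ⟦_⟧ : Bool → Carrier
  ⟦ false ⟧ = 0#
  ⟦ true  ⟧ = 1#

  𝔽₂⟶L : 𝔽₂ -Raw-AlmostCommutative⟶ fromCommutativeRing L
  𝔽₂⟶L = record
    { ⟦_⟧    = ⟦_⟧
    ; +-homo = ⟦⟧-xor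
    ; *-homo = ⟦⟧-∧
    ; -‿homo = ⟦⟧-neg
    ; 0-homo = refl
    ; 1-homo = refl
    }
    where
    ⟦⟧-xor : ∀ x y → ⟦ x xor y ⟧ ≈ ⟦ x ⟧ + ⟦ y ⟧
    ⟦⟧-xor false y     = sym (+-identityˡ _)
    ⟦⟧-xor true  false = sym (+-identityʳ _)
    ⟦⟧-xor true  true  = sym char2

    ⟦⟧-∧ : ∀ x y → ⟦ x ∧ y ⟧ ≈ ⟦ x ⟧ * ⟦ y ⟧
    ⟦⟧-∧ false y = sym (zeroˡ _)
    ⟦⟧-∧ true  y = sym (*-identityˡ _)

    ⟦⟧-neg : ∀ x → ⟦ x ⟧ ≈ - ⟦ x ⟧
    ⟦⟧-neg false = sym -0#≈0#
    ⟦⟧-neg true  = inverseʳ-unique 1# 1# char2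

  _≟𝔽₂_ : ∀ x y → Maybe (⟦ x ⟧ ≈ ⟦ y ⟧)
  false ≟𝔽₂ false = just refl
  true  ≟𝔽₂ true  = just refl
  _     ≟𝔽₂ _     = nothing

  open Algebra.Solver.Ring 𝔽₂ (fromCommutativeRing L) 𝔽₂⟶L _≟𝔽₂_
    using (solve; con; _:+_; _:*_; _:^_; _:=_)

  x+y≈z⇒x≈z+y : ∀ {x y z} → x + y ≈ z → x ≈ z + y
  x+y≈z⇒x≈z+y {x} {y} x+y≈z =
    trans (solve 2 (λ x y → x := (x :+ y) :+ y) refl x y) (+-congʳ x+y≈z)

  x+y≈0⇒x≈y : ∀ {x y} → x + y ≈ 0# → x ≈ y
  x+y≈0⇒x≈y {x} {y} x+y≈0 = trans (x+y≈z⇒x≈z+y x+y≈0) (+-identityˡ y)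

  frobenius-+ : ∀ n x y → (x + y) ^ (2 N.^ n) ≈ x ^ (2 N.^ n) + y ^ (2 N.^ n)
  frobenius-+ N.zero    = solve 2 (λ x y → (x :+ y) :^ 1 := x :^ 1 :+ y :^ 1) refl
  frobenius-+ (N.suc n) x y = begin
    (x + y) ^ (2 N.* Q)         ≈⟨ sym (^-assocʳ (x + y) 2 Q) ⟩
    ((x + y) ^ 2) ^ Q           ≈⟨ ^-congˡ Q (solve 2 (λ x y → (x :+ y) :^ 2 := x :^ 2 :+ y :^ 2) refl x y) ⟩
    (x ^ 2 + y ^ 2) ^ Q         ≈⟨ frobenius-+ n (x ^ 2) (y ^ 2) ⟩
    (x ^ 2) ^ Q + (y ^ 2) ^ Q   ≈⟨ +-cong (^-assocʳ x 2 Q) (^-assocʳ y 2 Q) ⟩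
    x ^ (2 N.* Q) + y ^ (2 N.* Q) ∎
    where
    Q : ℕ
    Q = 2 N.^ n

  InF-+ : ∀ {n x y} → InF (2 N.^ n) x → InF (2 N.^ n) y → InF (2 N.^ n) (x + y)
  InF-+ {n} {x} {y} x∈ y∈ = trans (frobenius-+ n x y) (+-cong x∈ y∈)

  AS-frobenius : ∀ n x → AS x ^ (2 N.^ n) ≈ AS (x ^ (2 N.^ n))
  AS-frobenius n x = begin
    (x + x ^ 2) ^ Q      ≈⟨ frobenius-+ n x (x ^ 2) ⟩
    x ^ Q + (x ^ 2) ^ Q  ≈⟨ +-congˡ (^-assocʳ x 2 Q) ⟩
    x ^ Q + x ^ (2 N.* Q) ≈⟨ +-congˡ (^-congʳ x (ℕₚ.*-comm 2 Q)) ⟩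
    x ^ Q + x ^ (Q N.* 2) ≈⟨ +-congˡ (sym (^-assocʳ x Q 2)) ⟩
    x ^ Q + (x ^ Q) ^ 2  ∎
    where
    Q : ℕ
    Q = 2 N.^ n

  AS-fibre⇒idempotent : ∀ {x y} → AS x ≈ AS y → (x + y) * (x + y) ≈ x + y
  AS-fibre⇒idempotent {x} {y} ASx≈ASy = begin
    (x + y) * (x + y)      ≈⟨ solve 2 (λ x y → (x :+ y) :* (x :+ y) := (x :+ x :^ 2) :+ (y :+ y :^ 2) :+ (x :+ y)) refl x y ⟩
    AS x + AS y + (x + y)  ≈⟨ +-congʳ (+-congʳ ASx≈ASy) ⟩
    AS y + AS y + (x + y)  ≈⟨ solve 2 (λ s t → s :+ s :+ t := t) refl (AS y) (x + y) ⟩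
    x + y                  ∎

  AS-preimage-InF : ∀ {n y w} → AS y ≈ w → InAS (2 N.^ n) w → InF (2 N.^ n) y
  AS-preimage-InF {n} {y} ASy≈w (x , x∈ , ASx≈w) =
    InF-resp {2 N.^ n} (solve 2 (λ x y → (x :+ y) :+ x := y) refl x y)
      (InF-+ {n} (idempotent⇒InF (AS-fibre⇒idempotent (trans ASx≈w (sym ASy≈w))) n) x∈)

  module _ (isField : IsField) where
    open IsField isField

    idempotent⇒≈1 : ∀ {x} → x * x ≈ x → ¬ (x ≈ 0#) → x ≈ 1#
    idempotent⇒≈1 {x} x·x≈x x≉0 with inverse x x≉0
    ... | x⁻¹ , x·x⁻¹≈1 = begin
      x             ≈⟨ sym (*-identityʳ x) ⟩
      x * 1#        ≈⟨ *-congˡ (sym x·x⁻¹≈1) ⟩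
      x * (x * x⁻¹) ≈⟨ sym (*-assoc x x x⁻¹) ⟩
      (x * x) * x⁻¹ ≈⟨ *-congʳ x·x≈x ⟩
      x * x⁻¹       ≈⟨ x·x⁻¹≈1 ⟩
      1#            ∎

    -- y ^ q is again a root of AS(t) = w, so y ^ q + y is an idempotent ≠ 0.
    AS-preimage-conjugate : ∀ {n y w} → AS y ≈ w → InF (2 N.^ n) w →
      ¬ InF (2 N.^ n) y → y ^ (2 N.^ n) ≈ 1# + y
    AS-preimage-conjugate {n} {y} {w} ASy≈w w∈ y∉ =
      x+y≈z⇒x≈z+y (idempotent⇒≈1 (AS-fibre⇒idempotent ASy^Q≈ASy) (y∉ ∘ x+y≈0⇒x≈y))
      where
      Q : ℕ
      Q = 2 N.^ n
      ASy^Q≈ASy : AS (y ^ Q) ≈ AS y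
      ASy^Q≈ASy = begin
        AS (y ^ Q) ≈⟨ sym (AS-frobenius n y) ⟩
        AS y ^ Q   ≈⟨ ^-congˡ Q ASy≈w ⟩
        w ^ Q      ≈⟨ w∈ ⟩
        w          ≈⟨ sym ASy≈w ⟩
        AS y       ∎

    module RootPair {n v u z z′ w} (v∈ : InF (2 N.^ n) v) (v·u≈1 : v * u ≈ 1#)
                    (v≈z+z′ : v ≈ z + z′) (AS[z·u]≈w : AS (z * u) ≈ w) where
      Q : ℕ
      Q = 2 N.^ n

      y : Carrier
      y = z * u

      z≈v·y : z ≈ v * y
      z≈v·y = sym (begin
        v * (z * u) ≈⟨ solve 3 (λ v z u → v :* (z :* u) := z :* (v :* u)) refl v z u ⟩
        z * (v * u) ≈⟨ *-congˡ v·u≈1 ⟩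
        z * 1#      ≈⟨ *-identityʳ z ⟩
        z           ∎)

      z′≈v+z : z′ ≈ v + z
      z′≈v+z = trans (solve 2 (λ z z′ → z′ := (z :+ z′) :+ z) refl z z′) (+-congʳ (sym v≈z+z′))

      z≈v+z′ : z ≈ v + z′
      z≈v+z′ = trans (solve 2 (λ z z′ → z := (z :+ z′) :+ z′) refl z z′) (+-congʳ (sym v≈z+z′))

      InAS⇒InF-roots : InAS Q w → InF Q z × InF Q z′
      InAS⇒InF-roots w∈AS = z∈ , InF-resp {Q} (sym z′≈v+z) (InF-+ {n} v∈ z∈)
        where
        z∈ : InF Q z
        z∈ = InF-resp {Q} (sym z≈v·y) (InF-* {Q} v∈ (AS-preimage-InF {n} AS[z·u]≈w w∈AS))

      ¬InAS⇒conjugate-roots : InF Q w → ¬ InAS Q w →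
        (InF (Q N.* Q) z × ¬ InF Q z) × (InF (Q N.* Q) z′ × ¬ InF Q z′) × (z′ ≈ z ^ Q)
      ¬InAS⇒conjugate-roots w∈ w∉AS =
        (swapped⇒InF-square {Q} z^Q≈z′ z′^Q≈z , z∉) ,
        (swapped⇒InF-square {Q} z′^Q≈z z^Q≈z′ , z′∉) ,
        sym z^Q≈z′
        where
        y∉ : ¬ InF Q y
        y∉ y∈ = w∉AS (y , y∈ , AS[z·u]≈w)

        z∉ : ¬ InF Q z
        z∉ z∈ = y∉ (InF-* {Q} z∈ (InF-inverse {Q} v∈ v·u≈1))

        z′∉ : ¬ InF Q z′
        z′∉ z′∈ = z∉ (InF-resp {Q} (sym z≈v+z′) (InF-+ {n} v∈ z′∈))

        z^Q≈z′ : z ^ Q ≈ z′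
        z^Q≈z′ = begin
          z ^ Q          ≈⟨ ^-congˡ Q z≈v·y ⟩
          (v * y) ^ Q    ≈⟨ ^-distrib-* v y Q ⟩
          v ^ Q * y ^ Q  ≈⟨ *-cong v∈ (AS-preimage-conjugate {n} AS[z·u]≈w w∈ y∉) ⟩
          v * (1# + y)   ≈⟨ distribˡ v 1# y ⟩
          v * 1# + v * y ≈⟨ +-cong (*-identityʳ v) (sym z≈v·y) ⟩
          v + z          ≈⟨ sym z′≈v+z ⟩
          z′             ∎

        z′^Q≈z : z′ ^ Q ≈ z
        z′^Q≈z = begin
          z′ ^ Q        ≈⟨ ^-congˡ Q z′≈v+z ⟩
          (v + z) ^ Q   ≈⟨ frobenius-+ n v z ⟩
          v ^ Q + z ^ Q ≈⟨ +-cong v∈ z^Q≈z′ ⟩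
          v + z′        ≈⟨ sym z≈v+z′ ⟩
          z             ∎

  P-root-pair : ∀ {a b v z z′} → P a b z ≈ 0# → P a b z′ ≈ 0# → v ≈ z + z′ →
    a * v * (a * (z * z′) * v ^ 3 + 1#) ≈ 0#
  P-root-pair {a} {b} {v} {z} {z′} Pz≈0 Pz′≈0 v≈z+z′ = begin
    a * v * (a * (z * z′) * v ^ 3 + 1#)
      ≈⟨ *-cong (*-congˡ v≈z+z′) (+-congʳ (*-congˡ (^-congˡ 3 v≈z+z′))) ⟩
    a * (z + z′) * (a * (z * z′) * (z + z′) ^ 3 + 1#)
      ≈⟨ solve 4 (λ a b z z′ →
           a :* (z :+ z′) :* (a :* (z :* z′) :* (z :+ z′) :^ 3 :+ con true)
           := z′ :* (a :^ 2 :* z :^ 5 :+ b :^ 2 :* z :+ a) :+ z :* (a :^ 2 :* z′ :^ 5 :+ b :^ 2 :* z′ :+ a))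
         refl a b z z′ ⟩
    z′ * P a b z + z * P a b z′
      ≈⟨ +-cong (*-congˡ Pz≈0) (*-congˡ Pz′≈0) ⟩
    z′ * 0# + z * 0#
      ≈⟨ solve 2 (λ z z′ → z′ :* con false :+ z :* con false := con false) refl z z′ ⟩
    0# ∎

  module QuinticRoots {a b v z z′ w} (Pz≈0 : P a b z ≈ 0#) (Pz′≈0 : P a b z′ ≈ 0#)
                      (v≈z+z′ : v ≈ z + z′) (w·av⁵≈1 : w * (a * v ^ 5) ≈ 1#) where
    v⁻¹ : Carrier
    v⁻¹ = w * (a * v ^ 4)

    v·v⁻¹≈1 : v * v⁻¹ ≈ 1#
    v·v⁻¹≈1 = trans (solve 3 (λ v w a → v :* (w :* (a :* v :^ 4)) := w :* (a :* v :^ 5)) refl v w a)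
                    w·av⁵≈1

    a·zz′·v³≈1 : a * (z * z′) * v ^ 3 ≈ 1#
    a·zz′·v³≈1 = trans (x+y≈z⇒x≈z+y (begin
      a * (z * z′) * v ^ 3 + 1#
        ≈⟨ sym (*-identityˡ _) ⟩
      1# * (a * (z * z′) * v ^ 3 + 1#)
        ≈⟨ *-congʳ (sym w·av⁵≈1) ⟩
      w * (a * v ^ 5) * (a * (z * z′) * v ^ 3 + 1#)
        ≈⟨ solve 4 (λ w a v t → w :* (a :* v :^ 5) :* t := w :* v :^ 4 :* (a :* v :* t))
             refl w a v (a * (z * z′) * v ^ 3 + 1#) ⟩
      w * v ^ 4 * (a * v * (a * (z * z′) * v ^ 3 + 1#))
        ≈⟨ *-congˡ (P-root-pair Pz≈0 Pz′≈0 v≈z+z′) ⟩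
      w * v ^ 4 * 0#
        ≈⟨ zeroʳ _ ⟩
      0# ∎)) (+-identityˡ 1#)

    AS[z·v⁻¹]≈w : AS (z * v⁻¹) ≈ w
    AS[z·v⁻¹]≈w = begin
      z * v⁻¹ + (z * v⁻¹) ^ 2
        ≈⟨ +-congʳ (sym (*-identityʳ _)) ⟩
      z * v⁻¹ * 1# + (z * v⁻¹) ^ 2
        ≈⟨ +-congʳ (*-congˡ (trans (sym v·v⁻¹≈1) (*-congʳ v≈z+z′))) ⟩
      z * v⁻¹ * ((z + z′) * v⁻¹) + (z * v⁻¹) ^ 2
        ≈⟨ solve 3 (λ z z′ u → z :* u :* ((z :+ z′) :* u) :+ (z :* u) :^ 2 := z :* z′ :* u :^ 2)
             refl z z′ v⁻¹ ⟩
      z * z′ * v⁻¹ ^ 2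
        ≈⟨ sym (*-identityˡ _) ⟩
      1# * (z * z′ * v⁻¹ ^ 2)
        ≈⟨ *-congʳ (sym w·av⁵≈1) ⟩
      w * (a * v ^ 5) * (z * z′ * v⁻¹ ^ 2)
        ≈⟨ solve 5 (λ w a v p u → w :* (a :* v :^ 5) :* (p :* u :^ 2)
                                  := w :* (a :* p :* v :^ 3) :* (v :* u) :^ 2)
             refl w a v (z * z′) v⁻¹ ⟩
      w * (a * (z * z′) * v ^ 3) * (v * v⁻¹) ^ 2
        ≈⟨ *-cong (*-congˡ a·zz′·v³≈1) (^-congˡ 2 v·v⁻¹≈1) ⟩
      w * 1# * 1# ^ 2
        ≈⟨ solve 1 (λ w → w :* con true :* con true :^ 2 := w) refl w ⟩
      w ∎

lemma2p2 : ∀ {c ℓ} (L : CommutativeRing c ℓ) →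
    let open CommutativeRing L
        open FieldNotions L
    in IsField → Char2 → AlgClosed →
    (m : ℕ) → 1 ≤ m →
    let q = 2 N.^ m in
    (a b v z z′ : Carrier) →
    InF q a → ¬ (a ≈ 0#) → InF q b → InF q v →
    (v ^ 5) * P a b v ≈ 1# →
    P a b z ≈ 0# → P a b z′ ≈ 0# → v ≈ z + z′ →
    (w : Carrier) → w * (a * v ^ 5) ≈ 1# →
    (InAS q w → InF q z × InF q z′) ×
    (¬ InAS q w →
      (InF (q N.* q) z × ¬ InF q z) × (InF (q N.* q) z′ × ¬ InF q z′) × (z′ ≈ z ^ q))
lemma2p2 L isField char2 _ m _ a b v z z′ a∈ _ _ v∈ _ Pz≈0 Pz′≈0 v≈z+z′ w w·av⁵≈1 =
  InAS⇒InF-roots , ¬InAS⇒conjugate-roots w∈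
  where
  open CommutativeRing L
  open FieldNotions L
  open FrobeniusFixedPoints L
  open Characteristic2 L char2
  open QuinticRoots Pz≈0 Pz′≈0 v≈z+z′ w·av⁵≈1

  q : ℕ
  q = 2 N.^ m

  w∈ : InF q w
  w∈ = InF-inverse {q} (InF-* {q} a∈ (InF-^ {q} v∈ 5)) (trans (*-comm _ _) w·av⁵≈1)

  open RootPair isField {m} v∈ v·v⁻¹≈1 v≈z+z′ AS[z·v⁻¹]≈w
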